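{- Let $r\ge1$ and let $\lambda\in\mathcal D_r$ be such that the skew Ferrers diagram $\sigma=\lambda\setminus\mu_r$ is strict (has reduced dimension $r$) and irreducible. If the density $|\sigma|/r$ is less than $1$, then $|\sigma|=r-1$, i.e. the density equals $\tfrac{r-1}{r}$.
   Context: A Ferrers diagram (FD) in $\mathbb{Z}_{\ge0}^{r}$ is a finite set $\lambda\subset\mathbb{Z}_{\ge0}^r$ (elements called nodes) such that if $\mathbf a\in\lambda$ and $0\le \mathbf x\le\mathbf a$ componentwise then $\mathbf x\in\lambda$. Let $\mu_r=\{0,e_1,\dots,e_r\}$. $\mathcal D_r$ is the set of FDs in $\mathbb{Z}_{\ge0}^r$ consisting of the nodes of $\mu_r$ together with some nodes of the form $e_i+e_j$ ($i\ne j$). The support of a node is the set of indices of its nonzero coordinates. For $\sigma=\lambda\setminus\mu_r$, the reduced dimension is the number of indices $i$ such that some node of $\sigma$ has nonzero $i$-th coordinate; $\sigma$ is strict if this equals $r$. $\sigma$ is reducible if there is a partition $\{1,\dots,r\}=S\sqcup T$ with $S,T$ nonempty and a nonempty proper subset $\sigma'\subsetneq\sigma$ such that the nodes of $\sigma'$ have support in $S$ and the nodes of $\sigma\setminus\sigma'$ have support in $T$; otherwise it is irreducible. The density of $\sigma$ is $|\sigma|/r$. -}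

module Defs where

open import Data.Nat using (ℕ; zero; suc; _+_; _≤_; _<_; _≟_)
open import Data.Bool using (Bool; true; false)
open import Data.Fin using (Fin)
open import Data.Fin.Subset using (Subset; _∈_; ∁; Nonempty)
open import Data.Vec using (Vec; lookup; replicate; zipWith; _[_]≔_)
open import Data.List using (List; length; filter)
open import Data.List.Base using (allFin)
import Data.List.Membership.Propositional as LM
open import Data.List.Relation.Unary.Any using (any?)
open import Data.List.Relation.Unary.Unique.Propositional using (Unique)
open import Data.Product using (Σ; ∃; _×_; _,_)
open import Data.Sum using (_⊎_)
open import Relation.Nullary using (¬_; ¬?)
open import Relation.Binary.PropositionalEquality using (_≡_; _≢_)

Node : ℕ → Set
Node r = Vec ℕ r

NodeSet : ℕ → Set
NodeSet r = List (Node r)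

_∈L_ : ∀ {r} → Node r → NodeSet r → Set
a ∈L s = a LM.∈ s

_≤ᶜ_ : ∀ {r} → Node r → Node r → Set
x ≤ᶜ a = ∀ i → lookup x i ≤ lookup a i

IsFD : ∀ {r} → NodeSet r → Set
IsFD {r} λ' = ∀ (a x : Node r) → a ∈L λ' → x ≤ᶜ a → x ∈L λ'

𝟎 : ∀ {r} → Node r
𝟎 {r} = replicate r 0

e : ∀ {r} → Fin r → Node r
e {r} i = replicate r 0 [ i ]≔ 1

_⊕_ : ∀ {r} → Node r → Node r → Node r
_⊕_ = zipWith _+_

Inμ : ∀ {r} → Node r → Set
Inμ a = a ≡ 𝟎 ⊎ ∃ λ i → a ≡ e i

InD : (r : ℕ) → NodeSet r → Set
InD r λ' =
  IsFD λ'
  × (∀ a → Inμ a → a ∈L λ')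
  × (∀ a → a ∈L λ' → Inμ a ⊎ Σ (Fin r) λ i → Σ (Fin r) λ j → i ≢ j × a ≡ e i ⊕ e j)

-- σ is (a duplicate-free list enumerating) λ ∖ μ_r
IsSkew : ∀ {r} → NodeSet r → NodeSet r → Set
IsSkew {r} λ' σ = Unique σ × (∀ (a : Node r) → (a ∈L σ → a ∈L λ' × ¬ Inμ a) × (a ∈L λ' × ¬ Inμ a → a ∈L σ))

-- cardinality of a (duplicate-free) node set
card : ∀ {r} → NodeSet r → ℕ
card = length

reducedDim : ∀ {r} → NodeSet r → ℕ
reducedDim {r} σ = length (filter (λ i → any? (λ a → ¬? (lookup a i ≟ 0)) σ) (allFin r))

Strict : ∀ {r} → NodeSet r → Set
Strict {r} σ = reducedDim σ ≡ r

SupportIn : ∀ {r} → Node r → Subset r → Set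
SupportIn a S = ∀ i → lookup a i ≢ 0 → i ∈ S

-- σ is reducible: a partition {1..r} = S ⊔ T (T = complement of S), both nonempty,
-- and a nonempty proper subset σ' ⊊ σ (given by its indicator f) with
-- nodes of σ' supported in S and nodes of σ ∖ σ' supported in T.
Reducible : ∀ {r} → NodeSet r → Set
Reducible {r} σ =
  Σ (Subset r) λ S → Nonempty S × Nonempty (∁ S) ×
  Σ (Node r → Bool) λ f →
    (∃ λ a → a ∈L σ × f a ≡ true) ×
    (∃ λ a → a ∈L σ × f a ≡ false) ×
    (∀ a → a ∈L σ → f a ≡ true → SupportIn a S) ×
    (∀ a → a ∈L σ → f a ≡ false → SupportIn a (∁ S))

Irreducible : ∀ {r} → NodeSet r → Set
Irreducible σ = ¬ Reducible σ

-- Read σ as a graph on the vertices 1, …, r whose edges are the nodes eᵢ + eⱼ. Starting from one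
-- vertex and repeatedly absorbing the other endpoint of an edge that meets the current set (and
-- discarding that edge), one reaches a set S of at most 1 + |σ| vertices that no edge crosses.
-- If S missed a vertex, strictness would provide edges inside S and inside its complement, and
-- splitting σ along S would contradict irreducibility. So S has all r vertices: r ≤ 1 + |σ|.
module Submission where

open import Defs
open import Data.Nat using (ℕ; _≤_; _<_; _∸_; zero; suc; _+_; z≤n; s≤s)
import Data.Nat as ℕ
open import Data.Nat.Properties
  using (≤-trans; ≤-reflexive; ≤-antisym; <-≤-trans; <⇒≢; +-suc; +-comm; +-monoʳ-≤; +-monoˡ-≤;
         n≤1+n; m≤m+n; module ≤-Reasoning)
open import Data.Nat.Induction using (<-wellFounded)
open import Induction.WellFounded using (Acc; acc)
open import Data.Fin using (Fin; zero; suc) renaming (_≟_ to _≟ᶠ_)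
open import Data.Fin.Properties using (all?; ¬∀⟶∃¬) renaming (any? to anyᶠ?)
open import Data.Fin.Subset using (Subset; _∈_; _∉_; _∪_; ⁅_⁆; ∁; ∣_∣; _⊆_; ⊤; inside; outside)
open import Data.Fin.Subset.Properties
  using (_∈?_; p⊆p∪q; q⊆p∪q; x∈⁅x⁆; ∣⁅x⁆∣≡1; p⊆q⇒∣p∣≤∣q∣; ∣⊤∣≡n; x∉p⇒x∈∁p; x∈∁p⇒x∉p)
open import Data.Vec using ([]; _∷_; lookup; replicate)
open import Data.Vec.Properties using (lookup-zipWith; lookup-replicate; lookup∘update′; ≡-dec)
open import Data.List using (length; filter; allFin)
open import Data.List.Properties using (filter-notAll; length-tabulate)
open import Data.List.Relation.Unary.Any using (any?)
import Data.List.Relation.Unary.Any as Any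
open import Data.List.Membership.Propositional using (find)
open import Data.List.Membership.Propositional.Properties using (∈-allFin; ∈-filter⁺; ∈-filter⁻)
open import Data.Product using (∃; ∃₂; _×_; _,_; proj₁)
open import Data.Sum using (_⊎_; inj₁; inj₂)
open import Data.Empty using (⊥-elim)
open import Data.Bool using (true; false)
open import Function using (id; _∘_)
open import Relation.Nullary using (¬_; Dec; yes; no; does; ¬?; contradiction)
open import Relation.Nullary.Decidable using (_×-dec_; _→-dec_; dec-true; dec-false)
open import Relation.Binary.PropositionalEquality using (_≡_; refl; sym; trans; cong; cong₂; _≢_)

private
  variable
    r : ℕ

∣p∪q∣≤∣p∣+∣q∣ : ∀ {n} (p q : Subset n) → ∣ p ∪ q ∣ ≤ ∣ p ∣ + ∣ q ∣
∣p∪q∣≤∣p∣+∣q∣ []            []            = z≤n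
∣p∪q∣≤∣p∣+∣q∣ (outside ∷ p) (outside ∷ q) = ∣p∪q∣≤∣p∣+∣q∣ p q
∣p∪q∣≤∣p∣+∣q∣ (inside ∷ p)  (outside ∷ q) = s≤s (∣p∪q∣≤∣p∣+∣q∣ p q)
∣p∪q∣≤∣p∣+∣q∣ (inside ∷ p)  (inside ∷ q)  =
  s≤s (≤-trans (∣p∪q∣≤∣p∣+∣q∣ p q) (+-monoʳ-≤ ∣ p ∣ (n≤1+n ∣ q ∣)))
∣p∪q∣≤∣p∣+∣q∣ (outside ∷ p) (inside ∷ q)  =
  ≤-trans (s≤s (∣p∪q∣≤∣p∣+∣q∣ p q)) (≤-reflexive (sym (+-suc ∣ p ∣ ∣ q ∣)))

∣p∪⁅x⁆∣≤1+∣p∣ : ∀ {n} (p : Subset n) (x : Fin n) → ∣ p ∪ ⁅ x ⁆ ∣ ≤ suc ∣ p ∣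
∣p∪⁅x⁆∣≤1+∣p∣ p x = ≤-trans (∣p∪q∣≤∣p∣+∣q∣ p ⁅ x ⁆)
  (≤-reflexive (trans (cong (∣ p ∣ +_) (∣⁅x⁆∣≡1 x)) (+-comm ∣ p ∣ 1)))

IsEdge : Node r → Set
IsEdge {r} a = ∃₂ λ (i j : Fin r) → a ≡ e i ⊕ e j

lookup-e-≢ : (i k : Fin r) → k ≢ i → lookup (e i) k ≡ 0
lookup-e-≢ {r} i k k≢i = trans (lookup∘update′ k≢i (replicate r 0) 1) (lookup-replicate k 0)

support-e⊕e : (i j k : Fin r) → lookup (e i ⊕ e j) k ≢ 0 → k ≡ i ⊎ k ≡ j
support-e⊕e i j k nz with k ≟ᶠ i | k ≟ᶠ j
... | yes k≡i | _       = inj₁ k≡i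
... | no _    | yes k≡j = inj₂ k≡j
... | no k≢i  | no k≢j  = ⊥-elim (nz (trans (lookup-zipWith _+_ k (e i) (e j))
                                         (cong₂ _+_ (lookup-e-≢ i k k≢i) (lookup-e-≢ j k k≢j))))

e⊕e-supportIn : ∀ {S : Subset r} {i j} → i ∈ S → j ∈ S → SupportIn (e i ⊕ e j) S
e⊕e-supportIn {i = i} {j} i∈S j∈S k nz with support-e⊕e i j k nz
... | inj₁ refl = i∈S
... | inj₂ refl = j∈S

Meets : Subset r → Node r → Set
Meets S a = ∃ λ k → lookup a k ≢ 0 × k ∈ S

meets? : (S : Subset r) (a : Node r) → Dec (Meets S a)
meets? S a = anyᶠ? (λ k → ¬? (lookup a k ℕ.≟ 0) ×-dec (k ∈? S))

¬Meets⇒SupportIn∁ : ∀ {S : Subset r} {a} → ¬ Meets S a → SupportIn a (∁ S)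
¬Meets⇒SupportIn∁ ¬meets k nz = x∉p⇒x∈∁p (λ k∈S → ¬meets (k , nz , k∈S))

edge-meeting⇒SupportIn∪⁅⁆ : ∀ {S : Subset r} {a} → IsEdge a → Meets S a →
                             ∃ λ j → SupportIn a (S ∪ ⁅ j ⁆)
edge-meeting⇒SupportIn∪⁅⁆ {S = S} (i , j , refl) (k , nz , k∈S) with support-e⊕e i j k nz
... | inj₁ refl = j , e⊕e-supportIn (p⊆p∪q _ k∈S) (q⊆p∪q S _ (x∈⁅x⁆ j))
... | inj₂ refl = i , e⊕e-supportIn (q⊆p∪q S _ (x∈⁅x⁆ i)) (p⊆p∪q _ k∈S)

_≟ⁿ_ : (a b : Node r) → Dec (a ≡ b)
_≟ⁿ_ = ≡-dec ℕ._≟_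

infixl 25 _without_

_without_ : NodeSet r → Node r → NodeSet r
E without a = filter (λ b → ¬? (b ≟ⁿ a)) E

∈⇒∣without∣< : ∀ {a} {E : NodeSet r} → a ∈L E → length (E without a) < length E
∈⇒∣without∣< {a = a} {E} a∈E =
  filter-notAll (λ b → ¬? (b ≟ⁿ a)) E (Any.map (λ { refl a≢a → a≢a refl }) a∈E)

∈-without⁻ : ∀ {a b} {E : NodeSet r} → b ∈L E without a → b ∈L E
∈-without⁻ {a = a} = proj₁ ∘ ∈-filter⁻ (λ b → ¬? (b ≟ⁿ a))

∈-without⁺ : ∀ {a b} {E : NodeSet r} → b ∈L E → b ≢ a → b ∈L E without a
∈-without⁺ {a = a} = ∈-filter⁺ (λ b → ¬? (b ≟ⁿ a))

Separates : Subset r → NodeSet r → Set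
Separates S E = ∀ {a} → a ∈L E → SupportIn a S ⊎ SupportIn a (∁ S)

separating-superset : (S : Subset r) (E : NodeSet r) → (∀ {a} → a ∈L E → IsEdge a) →
                      ∃ λ S′ → S ⊆ S′ × ∣ S′ ∣ ≤ ∣ S ∣ + length E × Separates S′ E
separating-superset S E edges = go S E edges (<-wellFounded (length E))
  where
  go : (S : Subset _) (E : NodeSet _) → (∀ {a} → a ∈L E → IsEdge a) → Acc _<_ (length E) →
       ∃ λ S′ → S ⊆ S′ × ∣ S′ ∣ ≤ ∣ S ∣ + length E × Separates S′ E
  go S E edges (acc rec) with any? (meets? S) E
  ... | no ¬meets = S , id , m≤m+n _ _ , λ {a} a∈E →
    inj₂ (¬Meets⇒SupportIn∁ {a = a} (λ m → ¬meets (Any.map (λ { refl → m }) a∈E)))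
  ... | yes meets
    with a , a∈E , a-meets ← find meets
    with j , a⊆S₁ ← edge-meeting⇒SupportIn∪⁅⁆ (edges a∈E) a-meets
    with S′ , S₁⊆S′ , ∣S′∣≤ , separates
           ← go (S ∪ ⁅ j ⁆) (E without a) (edges ∘ ∈-without⁻) (rec (∈⇒∣without∣< a∈E))
    = S′ , S₁⊆S′ ∘ p⊆p∪q _ , ∣S′∣≤∣S∣+∣E∣ , separates′
    where
    open ≤-Reasoning
    ∣S′∣≤∣S∣+∣E∣ : ∣ S′ ∣ ≤ ∣ S ∣ + length E
    ∣S′∣≤∣S∣+∣E∣ = begin
      ∣ S′ ∣                               ≤⟨ ∣S′∣≤ ⟩
      ∣ S ∪ ⁅ j ⁆ ∣ + length (E without a)  ≤⟨ +-monoˡ-≤ _ (∣p∪⁅x⁆∣≤1+∣p∣ S j) ⟩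
      suc ∣ S ∣ + length (E without a)      ≡⟨ sym (+-suc ∣ S ∣ _) ⟩
      ∣ S ∣ + suc (length (E without a))    ≤⟨ +-monoʳ-≤ ∣ S ∣ (∈⇒∣without∣< a∈E) ⟩
      ∣ S ∣ + length E                      ∎
    separates′ : Separates S′ E
    separates′ {b} b∈E with b ≟ⁿ a
    ... | yes refl = inj₁ (λ k nz → S₁⊆S′ (a⊆S₁ k nz))
    ... | no b≢a   = separates (∈-without⁺ b∈E b≢a)

skew-edges : ∀ {λ′ σ : NodeSet r} → InD r λ′ → IsSkew λ′ σ → ∀ {a} → a ∈L σ → IsEdge a
skew-edges (_ , _ , shape) (_ , skew) {a} a∈σ
  with a∈λ , a∉μ ← proj₁ (skew a) a∈σ
  with shape a a∈λ
... | inj₁ a∈μ              = contradiction a∈μ a∉μ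
... | inj₂ (i , j , _ , eq) = i , j , eq

Covers : NodeSet r → Set
Covers {r} σ = ∀ (k : Fin r) → ∃ λ a → a ∈L σ × lookup a k ≢ 0

strict⇒covers : ∀ {σ : NodeSet r} → Strict σ → Covers σ
strict⇒covers {r} {σ} strict k with any? (λ a → ¬? (lookup a k ℕ.≟ 0)) σ
... | yes some = find some
... | no none  = contradiction strict (<⇒≢ (<-≤-trans
      (filter-notAll used? (allFin r) (Any.map (λ { refl → none }) (∈-allFin k)))
      (≤-reflexive (length-tabulate id))))
  where used? = λ i → any? (λ a → ¬? (lookup a i ℕ.≟ 0)) σ

does≡true⇒ : ∀ {A : Set} (a? : Dec A) → does a? ≡ true → A
does≡true⇒ (yes a) _ = a

does≡false⇒¬ : ∀ {A : Set} (a? : Dec A) → does a? ≡ false → ¬ A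
does≡false⇒¬ (no ¬a) _ = ¬a

supportIn? : (S : Subset r) (a : Node r) → Dec (SupportIn a S)
supportIn? S a = all? (λ k → ¬? (lookup a k ℕ.≟ 0) →-dec (k ∈? S))

separates∧straddles⇒reducible : ∀ {σ : NodeSet r} {S a b i j} → Separates S σ →
                                a ∈L σ → lookup a i ≢ 0 → i ∈ S → b ∈L σ → lookup b j ≢ 0 → j ∉ S →
                                Reducible σ
separates∧straddles⇒reducible {σ = σ} {S} {a} {b} {i} {j}
                              separates a∈σ a[i]≢0 i∈S b∈σ b[j]≢0 j∉S =
  S , (i , i∈S) , (j , x∉p⇒x∈∁p j∉S) , does ∘ supportIn? S ,
  (a , a∈σ , dec-true (supportIn? S a) a⊆S) , (b , b∈σ , dec-false (supportIn? S b) b⊈S) ,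
  inS⇒SupportIn , ¬inS⇒SupportIn∁
  where
  a⊆S : SupportIn a S
  a⊆S with separates a∈σ
  ... | inj₁ a⊆S  = a⊆S
  ... | inj₂ a⊆∁S = contradiction i∈S (x∈∁p⇒x∉p (a⊆∁S i a[i]≢0))
  b⊈S : ¬ SupportIn b S
  b⊈S b⊆S = j∉S (b⊆S j b[j]≢0)
  inS⇒SupportIn : ∀ c → c ∈L σ → does (supportIn? S c) ≡ true → SupportIn c S
  inS⇒SupportIn c _ = does≡true⇒ (supportIn? S c)
  ¬inS⇒SupportIn∁ : ∀ c → c ∈L σ → does (supportIn? S c) ≡ false → SupportIn c (∁ S)
  ¬inS⇒SupportIn∁ c c∈σ not-inS with separates c∈σ
  ... | inj₁ c⊆S  = contradiction c⊆S (does≡false⇒¬ (supportIn? S c) not-inS)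
  ... | inj₂ c⊆∁S = c⊆∁S

m<n≤1+m⇒m≡n∸1 : ∀ {m n} → m < n → n ≤ suc m → m ≡ n ∸ 1
m<n≤1+m⇒m≡n∸1 {n = suc _} (s≤s m≤n∸1) (s≤s n∸1≤m) = ≤-antisym m≤n∸1 n∸1≤m

proposition4 : (r : ℕ) → 1 ≤ r → (λ' σ : NodeSet r) → InD r λ' → IsSkew λ' σ
    → Strict σ → Irreducible σ → card σ < r → card σ ≡ r ∸ 1
proposition4 (suc r) _ λ' σ inD skew strict irreducible ∣σ∣<r
  with S , ⁅0⁆⊆S , ∣S∣≤1+∣σ∣ , separates ← separating-superset ⁅ zero ⁆ σ (skew-edges inD skew)
  with all? (_∈? S)
... | yes all∈S = m<n≤1+m⇒m≡n∸1 ∣σ∣<r (begin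
      suc r                        ≡⟨ sym (∣⊤∣≡n (suc r)) ⟩
      ∣ ⊤ {suc r} ∣                ≤⟨ p⊆q⇒∣p∣≤∣q∣ {p = ⊤} {S} (λ {k} _ → all∈S k) ⟩
      ∣ S ∣                        ≤⟨ ∣S∣≤1+∣σ∣ ⟩
      ∣ ⁅ zero {r} ⁆ ∣ + length σ  ≡⟨ cong (_+ length σ) (∣⁅x⁆∣≡1 {suc r} zero) ⟩
      suc (length σ)               ∎)
  where open ≤-Reasoning
... | no ¬all∈S
  with j , j∉S ← ¬∀⟶∃¬ _ (_∈ S) (_∈? S) ¬all∈S
  with a , a∈σ , a[0]≢0 ← strict⇒covers strict zero
  with b , b∈σ , b[j]≢0 ← strict⇒covers strict j
  = ⊥-elim (irreducible
      (separates∧straddles⇒reducible separates a∈σ a[0]≢0 (⁅0⁆⊆S (x∈⁅x⁆ zero)) b∈σ b[j]≢0 j∉S))
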